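{- For wheel graphs, $\mathrm{nim}(\mathrm{GEN}(W_n))=\begin{cases} 2, & n=5\\ \mathrm{pty}(n), & n\geq 6. \end{cases}$
   Context: For $n\ge 5$, the wheel graph $W_n$ is the join $K_1+C_{n-1}$ of a central vertex with a cycle on $n-1$ vertices. For a graph $G=(V,E)$, a set of vertices is geodetically convex if it contains every vertex on every shortest path between two of its vertices; the convex hull $[P]$ is the smallest convex set containing $P$, and $P$ is generating if $[P]=V$. In the achievement game $\mathrm{GEN}(G)$, two players alternately select previously-unselected vertices; the game ends as soon as the selected set generates, and the last player to move wins. $\mathrm{nim}$ denotes the nim-number of an impartial game, and $\mathrm{pty}(n):=n\bmod 2$. -}

module Defs where

open import Data.Nat using (ℕ; zero; suc; _≤_; _≡ᵇ_)
open import Data.Fin using (Fin; zero; suc; toℕ)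
open import Data.Fin.Subset using (Subset; _∈_; _∉_; _⊆_; _∪_; ⁅_⁆; ⊥)
open import Data.Fin.Subset.Properties using (_∈?_)
open import Data.List using (List; []; _∷_; map; length; filter; allFin)
open import Data.Bool.ListAction using (any)
open import Data.Bool using (if_then_else_)
open import Data.Unit using (⊤)
open import Data.Empty renaming (⊥ to Empty)
open import Data.Product using (_×_)
open import Data.Sum using (_⊎_)
open import Relation.Nullary using (Dec; yes; no; ¬_)
open import Relation.Binary.PropositionalEquality using (_≡_)

Graph : ℕ → Set₁
Graph n = Fin n → Fin n → Set

-- Walks from u to v (a path in the paper's sense; shortest walks are paths).
data Walk {n : ℕ} (G : Graph n) : Fin n → Fin n → Set where
  [_]  : (u : Fin n) → Walk G u u
  _∷⟨_⟩_ : (u : Fin n) {w v : Fin n} → G u w → Walk G w v → Walk G u v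

len : ∀ {n} {G : Graph n} {u v} → Walk G u v → ℕ
len [ _ ]         = 0
len (_ ∷⟨ _ ⟩ p)  = suc (len p)

verts : ∀ {n} {G : Graph n} {u v} → Walk G u v → List (Fin n)
verts [ u ]        = u ∷ []
verts (u ∷⟨ _ ⟩ p) = u ∷ verts p

OnWalk : ∀ {n} {G : Graph n} {u v} → Fin n → Walk G u v → Set
OnWalk w p = Data.List.Membership.Propositional._∈_ w (verts p)
  where import Data.List.Membership.Propositional

Shortest : ∀ {n} {G : Graph n} {u v} → Walk G u v → Set
Shortest {G = G} {u} {v} p = (q : Walk G u v) → len p ≤ len q

Convex : ∀ {n} → Graph n → Subset n → Set
Convex G S = ∀ {u v} → u ∈ S → v ∈ S →
             (p : Walk G u v) → Shortest p →
             ∀ w → OnWalk w p → w ∈ S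

-- [P] = V : the convex hull (intersection of all convex sets containing P,
-- i.e. the smallest convex set containing P) is the whole vertex set.
Generating : ∀ {n} → Graph n → Subset n → Set
Generating G P = ∀ S → Convex G S → P ⊆ S → ∀ v → v ∈ S

-- Wheel graph W_n = K_1 + C_{n-1}: vertex zero is the centre, the
-- vertices suc i (i : Fin (n-1)) form the cycle 0 - 1 - ... - (n-2) - 0.

CycAdj : (m : ℕ) → Fin m → Fin m → Set
CycAdj m i j = (toℕ j ≡ suc (toℕ i)) ⊎ (toℕ i ≡ suc (toℕ j))
             ⊎ ((toℕ i ≡ 0) × (suc (toℕ j) ≡ m))
             ⊎ ((toℕ j ≡ 0) × (suc (toℕ i) ≡ m))

Wheel : (n : ℕ) → Graph n
Wheel (suc m) zero    zero    = Empty
Wheel (suc m) zero    (suc _) = ⊤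
Wheel (suc m) (suc _) zero    = ⊤
Wheel (suc m) (suc i) (suc j) = CycAdj m i j

mex : List ℕ → ℕ
mex xs = go (length xs) 0
  where
  go : ℕ → ℕ → ℕ
  go zero    k = k
  go (suc f) k = if any (_≡ᵇ k) xs then go f (suc k) else k

-- A position is the set P of selected
-- vertices. If P generates, the game is over (no options, nim 0);
-- otherwise the options are P ∪ {v} for unselected v, and the
-- nim-number is the mex of the options' nim-numbers.  `fuel` bounds
-- the remaining number of moves (at most n moves in total).
-- The game is parametrised by a decision procedure for Generating;
-- the result only depends on the yes/no answers, hence not on the choice.
module _ {n : ℕ} (G : Graph n) (gen? : (P : Subset n) → Dec (Generating G P)) where

  unselected : Subset n → List (Fin n)
  unselected P = filter (λ v → Relation.Nullary.¬? (v ∈? P)) (allFin n)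
    where import Relation.Nullary

  nimPos : ℕ → Subset n → ℕ
  nimPos zero     P = 0
  nimPos (suc f)  P with gen? P
  ... | yes _ = 0
  ... | no  _ = mex (map (λ v → nimPos f (P ∪ ⁅ v ⁆)) (unselected P))

  nimGEN : ℕ
  nimGEN = nimPos n ⊥

{-# OPTIONS --safe #-}
module Submission where

-- Call a rim edge of Wₙ free at a position P if neither endpoint is selected. Any two vertices
-- of Wₙ are at distance at most 2, and the centre and every rim vertex whose rim neighbours are
-- selected lie on geodesics between selected vertices; hence P generates iff no rim edge is
-- free. Let τ be the vertex cover number of the free edges. A move lowers τ by at most one; when
-- τ ≤ 2 some move lowers it (select a cover vertex), and if moreover an odd number of vertices
-- is unselected some move keeps it: τ ≥ 1 gives a free edge and τ ≥ 2 two disjoint ones (the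
-- rim has no triangles), and by parity some unselected vertex lies off them. By induction the
-- nim-number of P is nimValue (min τ 3) (parity of the number of unselected vertices). Finally
-- τ(C₄) = 2 and τ(C_{n-1}) ≥ 3 for n ≥ 6.

open import Defs
open import Data.Nat as ℕ
  using ( ℕ; zero; suc; pred; _≤_; _<_; s≤s; z≤n; _∸_; _*_; _%_; _≡ᵇ_; _≤?_
        ; _≤′_; ≤′-reflexive; ≤′-step; parity)
open import Data.Nat.Properties
  using ( <-irrefl; <-trans; ≤-trans; ≤-refl; ≤-reflexive; ≤-antisym; ≤-pred; n<1+n; n≤1+n
        ; <⇒≤; ≤∧≢⇒<; ≰⇒>; ≮⇒≥; m≤n⇒m<n∨m≡n; ≤⇒≤′; *-suc; *-monoʳ-≤; *-cancelˡ-≡; +-comm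
        ; even≢odd; ≡ᵇ⇒≡; ≡⇒≡ᵇ)
open import Data.Nat.DivMod using ([m+n]%n≡m%n)
open import Data.Parity.Base using (Parity; 0ℙ; 1ℙ; _⁻¹)
open import Data.Parity.Properties using (suc-homo-⁻¹; *-homo-*)
open import Data.Bool using (true; false)
open import Data.Bool.Properties using (T-≡; ¬-not)
open import Data.Bool.ListAction using (any)
open import Data.Fin using (Fin; zero; suc; toℕ; fromℕ<)
open import Data.Fin.Properties
  using (toℕ-injective; toℕ<n; toℕ-fromℕ<; suc-injective; ¬Fin0; any?; all?; pigeonhole)
  renaming (_≟_ to _≟ᶠ_)
open import Data.Fin.Subset using (Subset; inside; outside; _∈_; _∉_; _⊆_; _∪_; ⁅_⁆; ∁; ∣_∣; ⊥)
open import Data.Fin.Subset.Properties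
  using ( _∈?_; x∈p∪q⁻; x∈⁅y⁆⇒x≡y; x∈⁅x⁆; p⊆p∪q; q⊆p∪q; x∉p⇒x∈∁p; x∈∁p⇒x∉p; ∉⊥
        ; ∪-identityʳ; Empty-unique; ∣⊥∣≡0; ∣∁p∣≡n∸∣p∣)
open import Data.Vec using (Vec; []; _∷_; lookup; here; there)
open import Data.List using (List; []; _∷_; length; map; allFin)
open import Data.List.Membership.Propositional using () renaming (_∈_ to _∈ˡ_; _∉_ to _∉ˡ_)
open import Data.List.Membership.Propositional.Properties
  using (∈-map⁺; ∈-filter⁺; ∈-filter⁻; ∈-allFin)
open import Data.List.Relation.Unary.All as All using (All; _∷_)
open import Data.List.Relation.Unary.All.Properties as All using ()
open import Data.List.Relation.Unary.Any as Any using ()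
open import Data.List.Relation.Unary.Any.Properties using (any⁺; any⁻)
open import Data.Product using (Σ; ∃; ∃₂; _×_; _,_; proj₁; proj₂)
open import Data.Sum as Sum using (_⊎_; inj₁; inj₂; [_,_]′; reduce)
open import Data.Empty using (⊥-elim) renaming (⊥ to Empty)
open import Data.Unit using (tt)
open import Function using (_∘_)
open import Function.Bundles using (Equivalence; _⇔_; mk⇔)
open import Relation.Nullary using (¬_; Dec; yes; no; ¬?; contradiction)
open import Relation.Nullary.Decidable
  using (map′; _×-dec_; _⊎-dec_; _→-dec_; decidable-stable; from-yes; from-no)
open import Relation.Binary.PropositionalEquality
  using (_≡_; _≢_; refl; sym; trans; cong; subst; module ≡-Reasoning)

between-suc : ∀ {k c} → k ≤ c → c ≤ suc k → c ≡ k ⊎ c ≡ suc k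
between-suc k≤c c≤k+1 with m≤n⇒m<n∨m≡n c≤k+1
... | inj₁ c<k+1 = inj₁ (≤-antisym (≤-pred c<k+1) k≤c)
... | inj₂ c≡k+1 = inj₂ c≡k+1

pair-index : ∀ {x a b} → x ≡ 2 * a ⊎ x ≡ suc (2 * a) → x ≡ 2 * b ⊎ x ≡ suc (2 * b) → a ≡ b
pair-index {a = a} {b} (inj₁ refl) (inj₁ 2a≡2b)     = *-cancelˡ-≡ a b 2 2a≡2b
pair-index {a = a} {b} (inj₁ refl) (inj₂ 2a≡2b+1)   = contradiction 2a≡2b+1 (even≢odd a b)
pair-index {a = a} {b} (inj₂ refl) (inj₁ 2a+1≡2b)   = contradiction (sym 2a+1≡2b) (even≢odd b a)
pair-index {a = a} {b} (inj₂ refl) (inj₂ 2a+1≡2b+1) = *-cancelˡ-≡ a b 2 (cong pred 2a+1≡2b+1)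

∃-Vec? : ∀ {a p} {A : Set a} {k} {Q : Vec A k → Set p} →
         (∀ {q} {R : A → Set q} → (∀ x → Dec (R x)) → Dec (∃ R)) →
         (∀ xs → Dec (Q xs)) → Dec (∃ Q)
∃-Vec? {k = zero}  search Q? = map′ ([] ,_) (λ { ([] , q) → q }) (Q? [])
∃-Vec? {k = suc k} search Q? =
  map′ (λ { (x , xs , q) → x ∷ xs , q }) (λ { (x ∷ xs , q) → x , xs , q })
       (search λ x → ∃-Vec? search λ xs → Q? (x ∷ xs))

module _ {n : ℕ} where

  x∉p∪⁅y⁆⁺ : ∀ {p : Subset n} {x y} → x ∉ p → x ≢ y → x ∉ p ∪ ⁅ y ⁆
  x∉p∪⁅y⁆⁺ {p} {y = y} x∉p x≢y x∈ =
    [ x∉p , (λ x∈y → x≢y (x∈⁅y⁆⇒x≡y y x∈y)) ]′ (x∈p∪q⁻ p ⁅ y ⁆ x∈)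

  x∉p∪⁅y⁆⁻ : ∀ {p : Subset n} {x y} → x ∉ p ∪ ⁅ y ⁆ → x ∉ p × x ≢ y
  x∉p∪⁅y⁆⁻ {p} {y = y} x∉ =
    (λ x∈p → x∉ (p⊆p∪q ⁅ y ⁆ x∈p)) , (λ { refl → x∉ (q⊆p∪q p ⁅ y ⁆ (x∈⁅x⁆ y)) })

  x∈∁⁅a⁆∪⁅b⁆⁺ : ∀ {x} a b → x ≢ a → x ≢ b → x ∈ ∁ (⁅ a ⁆ ∪ ⁅ b ⁆)
  x∈∁⁅a⁆∪⁅b⁆⁺ a b x≢a x≢b = x∉p⇒x∈∁p (x∉p∪⁅y⁆⁺ (λ x∈a → x≢a (x∈⁅y⁆⇒x≡y a x∈a)) x≢b)

  x∈∁⁅a⁆∪⁅b⁆⁻ : ∀ {x} a b → x ∈ ∁ (⁅ a ⁆ ∪ ⁅ b ⁆) → x ≢ a × x ≢ b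
  x∈∁⁅a⁆∪⁅b⁆⁻ a b x∈ with x∉p∪⁅y⁆⁻ (x∈∁p⇒x∉p x∈)
  ... | x∉a , x≢b = (λ { refl → x∉a (x∈⁅x⁆ a) }) , x≢b

∣∁p∣≡1+∣∁p∪⁅x⁆∣ : ∀ {n} (p : Subset n) x → x ∉ p → ∣ ∁ p ∣ ≡ suc ∣ ∁ (p ∪ ⁅ x ⁆) ∣
∣∁p∣≡1+∣∁p∪⁅x⁆∣ (outside ∷ p) zero    _   = cong (λ q → suc ∣ ∁ q ∣) (sym (∪-identityʳ p))
∣∁p∣≡1+∣∁p∪⁅x⁆∣ (inside  ∷ p) zero    x∉p = contradiction here x∉p
∣∁p∣≡1+∣∁p∪⁅x⁆∣ (outside ∷ p) (suc x) x∉p = cong suc (∣∁p∣≡1+∣∁p∪⁅x⁆∣ p x (x∉p ∘ there))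
∣∁p∣≡1+∣∁p∪⁅x⁆∣ (inside  ∷ p) (suc x) x∉p = ∣∁p∣≡1+∣∁p∪⁅x⁆∣ p x (x∉p ∘ there)

∈⇒any≡true : ∀ {k xs} → k ∈ˡ xs → any (_≡ᵇ k) xs ≡ true
∈⇒any≡true {k} k∈xs =
  Equivalence.to T-≡ (any⁺ (_≡ᵇ k) (Any.map (λ { refl → ≡⇒≡ᵇ k k refl }) k∈xs))

∉⇒any≡false : ∀ {k xs} → k ∉ˡ xs → any (_≡ᵇ k) xs ≡ false
∉⇒any≡false {k} {xs} k∉xs = ¬-not λ any≡true →
  k∉xs (Any.map (λ x≡ᵇk → sym (≡ᵇ⇒≡ _ k x≡ᵇk)) (any⁻ (_≡ᵇ k) xs (Equivalence.from T-≡ any≡true)))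

mex≡0 : ∀ {xs} → 0 ∉ˡ xs → mex xs ≡ 0
mex≡0 {[]}    _  = refl
mex≡0 {_ ∷ _} 0∉ rewrite ∉⇒any≡false 0∉ = refl

mex≡1 : ∀ {xs} → 0 ∈ˡ xs → 1 ∉ˡ xs → mex xs ≡ 1
mex≡1 {_ ∷ xs} 0∈ 1∉ with length xs
... | zero  rewrite ∈⇒any≡true 0∈ = refl
... | suc _ rewrite ∈⇒any≡true 0∈ | ∉⇒any≡false 1∉ = refl

mex≡2 : ∀ {xs} → 0 ∈ˡ xs → 1 ∈ˡ xs → 2 ∉ˡ xs → mex xs ≡ 2
mex≡2 {_ ∷ []}     (Any.here refl) (Any.here ())  _
mex≡2 {_ ∷ []}     (Any.here refl) (Any.there ()) _
mex≡2 {_ ∷ _ ∷ xs} 0∈ 1∈ 2∉ with length xs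
... | zero  rewrite ∈⇒any≡true 0∈ | ∈⇒any≡true 1∈ = refl
... | suc _ rewrite ∈⇒any≡true 0∈ | ∈⇒any≡true 1∈ | ∉⇒any≡false 2∉ = refl

∉-of-All : ∀ {P : ℕ → Set} {k xs} → All P xs → ¬ P k → k ∉ˡ xs
∉-of-All all ¬Pk k∈xs = ¬Pk (All.lookup all k∈xs)

nimValue : ℕ → Parity → ℕ
nimValue 0                   _  = 0
nimValue 1                   0ℙ = 1
nimValue 1                   1ℙ = 2
nimValue 2                   0ℙ = 0
nimValue 2                   1ℙ = 2
nimValue (suc (suc (suc _))) 0ℙ = 0
nimValue (suc (suc (suc _))) 1ℙ = 1

nimValue-3-parity : ∀ n → nimValue 3 (parity n) ≡ n % 2
nimValue-3-parity 0             = refl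
nimValue-3-parity 1             = refl
nimValue-3-parity (suc (suc n)) =
  trans (nimValue-3-parity n) (trans (sym ([m+n]%n≡m%n n 2)) (cong (_% 2) (+-comm n 2)))

-- xs are the nim-values of the options of a position of class suc k with p the parity of its
-- number of unselected vertices.
mex-options : ∀ k p xs → k ≤ 2 →
  All (λ x → x ≡ nimValue k (p ⁻¹) ⊎ x ≡ nimValue (suc k) (p ⁻¹)) xs →
  xs ≢ [] →
  (k ≤ 1 → nimValue k (p ⁻¹) ∈ˡ xs) →
  (k ≤ 1 → p ≡ 1ℙ → nimValue (suc k) (p ⁻¹) ∈ˡ xs) →
  mex xs ≡ nimValue (suc k) p
mex-options 0 0ℙ _ _ values _ down _ =
  mex≡1 (down z≤n) (∉-of-All values λ { (inj₁ ()) ; (inj₂ ()) })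
mex-options 0 1ℙ _ _ values _ down same =
  mex≡2 (down z≤n) (same z≤n refl) (∉-of-All values λ { (inj₁ ()) ; (inj₂ ()) })
mex-options 1 0ℙ _ _ values _ _ _ =
  mex≡0 (∉-of-All values λ { (inj₁ ()) ; (inj₂ ()) })
mex-options 1 1ℙ _ _ values _ down same =
  mex≡2 (same (s≤s z≤n) refl) (down (s≤s z≤n)) (∉-of-All values λ { (inj₁ ()) ; (inj₂ ()) })
mex-options 2 0ℙ _ _ values _ _ _ =
  mex≡0 (∉-of-All values λ { (inj₁ ()) ; (inj₂ ()) })
mex-options 2 1ℙ []      _ _ nonempty _ _ = contradiction refl nonempty
mex-options 2 1ℙ (_ ∷ _) _ values@(x≡0 ∷ _) _ _ _ =
  mex≡1 (Any.here (sym (reduce x≡0))) (∉-of-All values λ { (inj₁ ()) ; (inj₂ ()) })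
mex-options (suc (suc (suc _))) _ _ (s≤s (s≤s ())) _ _ _ _

module _ {n : ℕ} {G : Graph n} where

  walk-length≥2 : ∀ {u v} → u ≢ v → ¬ G u v → (q : Walk G u v) → 2 ≤ len q
  walk-length≥2 u≢v _    [ _ ]                  = ⊥-elim (u≢v refl)
  walk-length≥2 _   ¬Guv (_ ∷⟨ e ⟩ [ _ ])         = ⊥-elim (¬Guv e)
  walk-length≥2 _   _    (_ ∷⟨ _ ⟩ (_ ∷⟨ _ ⟩ _)) = s≤s (s≤s z≤n)

  MidpointClosed : Subset n → Set
  MidpointClosed S = ∀ {u x v} → u ∈ S → v ∈ S → u ≢ v → ¬ G u v → G u x → G x v → x ∈ S

  convex⇒midpointClosed : ∀ {S} → Convex G S → MidpointClosed S
  convex⇒midpointClosed conv {u} {x} {v} u∈S v∈S u≢v ¬Guv ux xv =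
    conv u∈S v∈S (u ∷⟨ ux ⟩ (x ∷⟨ xv ⟩ [ v ])) (walk-length≥2 u≢v ¬Guv)
         x (Any.there (Any.here refl))

  Diameter≤2 : Set
  Diameter≤2 = ∀ u v → Σ (Walk G u v) λ q → len q ≤ 2

  midpointClosed⇒convex : Diameter≤2 → ∀ {S} → MidpointClosed S → Convex G S
  midpointClosed⇒convex diam {S} closed {u} {v} u∈S v∈S p shortest _ w∈p =
    on-geodesic p shortest w∈p
    where
    on-geodesic : (p : Walk G u v) → Shortest p → ∀ {w} → OnWalk w p → w ∈ S
    on-geodesic [ _ ]                         _  (Any.here refl)                         = u∈S
    on-geodesic (_ ∷⟨ _ ⟩ [ _ ])              _  (Any.here refl)                         = u∈S
    on-geodesic (_ ∷⟨ _ ⟩ [ _ ])              _  (Any.there (Any.here refl))             = v∈S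
    on-geodesic (_ ∷⟨ _ ⟩ (_ ∷⟨ _ ⟩ [ _ ]))   _  (Any.here refl)                         = u∈S
    on-geodesic (_ ∷⟨ _ ⟩ (_ ∷⟨ _ ⟩ [ _ ]))   _  (Any.there (Any.there (Any.here refl))) = v∈S
    on-geodesic (_ ∷⟨ ux ⟩ (_ ∷⟨ xv ⟩ [ _ ])) sh (Any.there (Any.here refl))             =
      closed u∈S v∈S u≢v ¬Guv ux xv
      where
      u≢v : u ≢ v
      u≢v refl with () ← sh [ u ]
      ¬Guv : ¬ G u v
      ¬Guv e with s≤s () ← sh (u ∷⟨ e ⟩ [ v ])
    on-geodesic (_ ∷⟨ _ ⟩ (_ ∷⟨ _ ⟩ (_ ∷⟨ _ ⟩ _))) sh _
      with s≤s (s≤s ()) ← ≤-trans (sh (proj₁ (diam u v))) (proj₂ (diam u v))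

Next : ℕ → ℕ → ℕ → Set
Next m x y = y ≡ suc x ⊎ (y ≡ 0 × suc x ≡ m)

Next-functional : ∀ {m x y z} → Next m x y → Next m x z → y < m → z < m → y ≡ z
Next-functional (inj₁ refl)          (inj₁ refl)          _   _   = refl
Next-functional (inj₁ refl)          (inj₂ (refl , refl)) y<m _   = ⊥-elim (<-irrefl refl y<m)
Next-functional (inj₂ (refl , refl)) (inj₁ refl)          _   z<m = ⊥-elim (<-irrefl refl z<m)
Next-functional (inj₂ (refl , _))    (inj₂ (refl , _))    _   _   = refl

Next-injective : ∀ {m x y z} → Next m x z → Next m y z → x ≡ y
Next-injective (inj₁ refl)          (inj₁ refl)       = refl
Next-injective (inj₁ refl)          (inj₂ (() , _))
Next-injective (inj₂ (refl , _))    (inj₁ ())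
Next-injective (inj₂ (refl , refl)) (inj₂ (_ , refl)) = refl

Next-irrefl : ∀ {m x} → 2 ≤ m → ¬ Next m x x
Next-irrefl _        (inj₁ ())
Next-irrefl (s≤s ()) (inj₂ (refl , refl))

Next-asym : ∀ {m x y} → 3 ≤ m → Next m x y → ¬ Next m y x
Next-asym (s≤s (s≤s (s≤s _))) (inj₁ refl)          (inj₁ ())
Next-asym (s≤s (s≤s (s≤s _))) (inj₁ refl)          (inj₂ (refl , ()))
Next-asym (s≤s (s≤s (s≤s _))) (inj₂ (refl , refl)) (inj₁ ())
Next-asym (s≤s (s≤s (s≤s _))) (inj₂ (refl , refl)) (inj₂ (() , _))

Next-no-3-cycle : ∀ {m x y z} → 4 ≤ m → Next m x y → Next m y z → ¬ Next m z x
Next-no-3-cycle (s≤s (s≤s (s≤s (s≤s _)))) (inj₁ refl)          (inj₁ refl)          (inj₁ ())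
Next-no-3-cycle (s≤s (s≤s (s≤s (s≤s _)))) (inj₁ refl)          (inj₁ refl)          (inj₂ (refl , ()))
Next-no-3-cycle (s≤s (s≤s (s≤s (s≤s _)))) (inj₁ refl)          (inj₂ (refl , refl)) (inj₁ ())
Next-no-3-cycle (s≤s (s≤s (s≤s (s≤s _)))) (inj₁ refl)          (inj₂ (refl , refl)) (inj₂ (() , _))
Next-no-3-cycle (s≤s (s≤s (s≤s (s≤s _)))) (inj₂ (refl , refl)) (inj₁ refl)          (inj₁ ())
Next-no-3-cycle (s≤s (s≤s (s≤s (s≤s _)))) (inj₂ (refl , refl)) (inj₁ refl)          (inj₂ (() , _))
Next-no-3-cycle (s≤s (s≤s (s≤s (s≤s _)))) (inj₂ (refl , refl)) (inj₂ (refl , ()))   _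

Next-predecessor : ∀ {m} x → x < m → ∃ λ p → p < m × Next m p x
Next-predecessor {suc m} zero    _   = m , ≤-refl , inj₂ (refl , refl)
Next-predecessor         (suc x) x<m = x , <-trans (n<1+n x) x<m , inj₁ refl

Next-successor : ∀ {m} x → x < m → ∃ λ s → s < m × Next m x s
Next-successor {m} x x<m with suc x ℕ.≟ m
... | yes x+1≡m = 0 , ≤-trans (s≤s z≤n) x<m , inj₂ (refl , x+1≡m)
... | no  x+1≢m = suc x , ≤∧≢⇒< x<m x+1≢m , inj₁ refl

module _ {m : ℕ} where

  CycAdj⇒Next : ∀ {i j : Fin m} → CycAdj m i j → Next m (toℕ i) (toℕ j) ⊎ Next m (toℕ j) (toℕ i)
  CycAdj⇒Next (inj₁ e)               = inj₁ (inj₁ e)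
  CycAdj⇒Next (inj₂ (inj₁ e))        = inj₂ (inj₁ e)
  CycAdj⇒Next (inj₂ (inj₂ (inj₁ e))) = inj₂ (inj₂ e)
  CycAdj⇒Next (inj₂ (inj₂ (inj₂ e))) = inj₁ (inj₂ e)

  Next⇒CycAdj : ∀ {i j : Fin m} → Next m (toℕ i) (toℕ j) → CycAdj m i j
  Next⇒CycAdj (inj₁ e) = inj₁ e
  Next⇒CycAdj (inj₂ e) = inj₂ (inj₂ (inj₂ e))

  Next⇒CycAdj˘ : ∀ {i j : Fin m} → Next m (toℕ j) (toℕ i) → CycAdj m i j
  Next⇒CycAdj˘ (inj₁ e) = inj₂ (inj₁ e)
  Next⇒CycAdj˘ (inj₂ e) = inj₂ (inj₂ (inj₁ e))

  CycAdj-sym : ∀ {i j : Fin m} → CycAdj m i j → CycAdj m j i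
  CycAdj-sym ij with CycAdj⇒Next ij
  ... | inj₁ i→j = Next⇒CycAdj˘ i→j
  ... | inj₂ j→i = Next⇒CycAdj j→i

  CycAdj-irrefl : ∀ {i : Fin m} → 2 ≤ m → ¬ CycAdj m i i
  CycAdj-irrefl 2≤m ii with CycAdj⇒Next ii
  ... | inj₁ i→i = Next-irrefl 2≤m i→i
  ... | inj₂ i→i = Next-irrefl 2≤m i→i

  private
    functional : ∀ {i j k : Fin m} → Next m (toℕ i) (toℕ j) → Next m (toℕ i) (toℕ k) → j ≡ k
    functional i→j i→k = toℕ-injective (Next-functional i→j i→k (toℕ<n _) (toℕ<n _))

    injective : ∀ {i j k : Fin m} → Next m (toℕ i) (toℕ k) → Next m (toℕ j) (toℕ k) → i ≡ j
    injective i→k j→k = toℕ-injective (Next-injective i→k j→k)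

  CycAdj-degree≤2 : ∀ {i a b c : Fin m} → CycAdj m i a → CycAdj m i b → CycAdj m i c →
                    a ≡ b ⊎ a ≡ c ⊎ b ≡ c
  CycAdj-degree≤2 ia ib ic with CycAdj⇒Next ia | CycAdj⇒Next ib | CycAdj⇒Next ic
  ... | inj₁ i→a | inj₁ i→b | _        = inj₁ (functional i→a i→b)
  ... | inj₂ a→i | inj₂ b→i | _        = inj₁ (injective a→i b→i)
  ... | inj₁ i→a | inj₂ _   | inj₁ i→c = inj₂ (inj₁ (functional i→a i→c))
  ... | inj₁ _   | inj₂ b→i | inj₂ c→i = inj₂ (inj₂ (injective b→i c→i))
  ... | inj₂ a→i | inj₁ _   | inj₂ c→i = inj₂ (inj₁ (injective a→i c→i))
  ... | inj₂ _   | inj₁ i→b | inj₁ i→c = inj₂ (inj₂ (functional i→b i→c))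

  CycAdj-triangle-free : ∀ {i j k : Fin m} → 4 ≤ m → CycAdj m i j → CycAdj m j k → ¬ CycAdj m i k
  CycAdj-triangle-free {i} {j} {k} 4≤m ij jk ik =
    triangle (CycAdj⇒Next ij) (CycAdj⇒Next jk) (CycAdj⇒Next ik)
    where
    2≤m : 2 ≤ m
    2≤m = ≤-trans (s≤s (s≤s z≤n)) 4≤m
    triangle : Next m (toℕ i) (toℕ j) ⊎ Next m (toℕ j) (toℕ i) →
               Next m (toℕ j) (toℕ k) ⊎ Next m (toℕ k) (toℕ j) →
               Next m (toℕ i) (toℕ k) ⊎ Next m (toℕ k) (toℕ i) → Empty
    triangle (inj₁ i→j) (inj₁ j→k) (inj₂ k→i) = Next-no-3-cycle 4≤m i→j j→k k→i
    triangle (inj₂ j→i) (inj₂ k→j) (inj₁ i→k) = Next-no-3-cycle 4≤m i→k k→j j→i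
    triangle (inj₁ i→j) _          (inj₁ i→k) with refl ← functional i→j i→k = CycAdj-irrefl 2≤m jk
    triangle (inj₂ j→i) (inj₁ j→k) _          with refl ← functional j→i j→k = CycAdj-irrefl 2≤m ik
    triangle (inj₁ i→j) (inj₂ k→j) _          with refl ← injective i→j k→j  = CycAdj-irrefl 2≤m ik
    triangle _          (inj₂ k→j) (inj₂ k→i) with refl ← functional k→j k→i = CycAdj-irrefl 2≤m ij

  CycAdj-neighbours : 4 ≤ m → (i : Fin m) →
                      ∃₂ λ p s → CycAdj m p i × CycAdj m i s × p ≢ s × ¬ CycAdj m p s
  CycAdj-neighbours 4≤m i
    with Next-predecessor (toℕ i) (toℕ<n i) | Next-successor (toℕ i) (toℕ<n i)
  ... | p , p<m , p→i | s , s<m , i→s =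
    fromℕ< p<m , fromℕ< s<m , Next⇒CycAdj p→i′ , Next⇒CycAdj i→s′ , p≢s ,
    CycAdj-triangle-free 4≤m (Next⇒CycAdj p→i′) (Next⇒CycAdj i→s′)
    where
    p→i′ : Next m (toℕ (fromℕ< p<m)) (toℕ i)
    p→i′ = subst (λ x → Next m x (toℕ i)) (sym (toℕ-fromℕ< p<m)) p→i
    i→s′ : Next m (toℕ i) (toℕ (fromℕ< s<m))
    i→s′ = subst (Next m (toℕ i)) (sym (toℕ-fromℕ< s<m)) i→s
    p≢s : fromℕ< p<m ≢ fromℕ< s<m
    p≢s p≡s = Next-asym (≤-trans (s≤s (s≤s (s≤s z≤n))) 4≤m) p→i′
                (subst (λ x → Next m (toℕ i) (toℕ x)) (sym p≡s) i→s′)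

module WheelPositions (m : ℕ) (4≤m : 4 ≤ m) where

  W : Graph (suc m)
  W = Wheel (suc m)

  2≤m : 2 ≤ m
  2≤m = ≤-trans (s≤s (s≤s z≤n)) 4≤m

  FreeEdge : Subset (suc m) → Fin m × Fin m → Set
  FreeEdge P (i , j) = CycAdj m i j × suc i ∉ P × suc j ∉ P

  wheel-diameter≤2 : Diameter≤2 {G = W}
  wheel-diameter≤2 zero    zero    = [ zero ] , z≤n
  wheel-diameter≤2 zero    (suc b) = zero ∷⟨ tt ⟩ [ suc b ] , s≤s z≤n
  wheel-diameter≤2 (suc a) zero    = suc a ∷⟨ tt ⟩ [ zero ] , s≤s z≤n
  wheel-diameter≤2 (suc a) (suc b) = suc a ∷⟨ tt ⟩ (zero ∷⟨ tt ⟩ [ suc b ]) , s≤s (s≤s z≤n)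

  rim-geodesic-ends : ∀ {u v i j} → CycAdj m i j → u ≢ v → ¬ W u v → W u (suc i) → W (suc i) v →
                      u ≡ suc j ⊎ v ≡ suc j
  rim-geodesic-ends {zero}  {zero}  _  u≢v _    _  _  = ⊥-elim (u≢v refl)
  rim-geodesic-ends {zero}  {suc _} _  _   ¬Wuv _  _  = ⊥-elim (¬Wuv tt)
  rim-geodesic-ends {suc _} {zero}  _  _   ¬Wuv _  _  = ⊥-elim (¬Wuv tt)
  rim-geodesic-ends {suc _} {suc _} ij u≢v _    ai ib with CycAdj-degree≤2 (CycAdj-sym ai) ib ij
  ... | inj₁ refl        = ⊥-elim (u≢v refl)
  ... | inj₂ (inj₁ refl) = inj₁ refl
  ... | inj₂ (inj₂ refl) = inj₂ refl

  generating⇒no-free-edge : ∀ {P} → Generating W P → ∀ e → ¬ FreeEdge P e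
  generating⇒no-free-edge {P} gen (i , j) (ij , i∉P , j∉P) =
    proj₁ (avoids (gen S S-convex P⊆S (suc i))) refl
    where
    S : Subset (suc m)
    S = ∁ (⁅ suc i ⁆ ∪ ⁅ suc j ⁆)
    avoids : ∀ {x} → x ∈ S → x ≢ suc i × x ≢ suc j
    avoids = x∈∁⁅a⁆∪⁅b⁆⁻ (suc i) (suc j)
    P⊆S : P ⊆ S
    P⊆S x∈P = x∈∁⁅a⁆∪⁅b⁆⁺ (suc i) (suc j) (λ { refl → i∉P x∈P }) (λ { refl → j∉P x∈P })
    S-convex : Convex W S
    S-convex = midpointClosed⇒convex wheel-diameter≤2 λ u∈S v∈S u≢v ¬Wuv ux xv →
      x∈∁⁅a⁆∪⁅b⁆⁺ (suc i) (suc j)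
        (λ { refl → [ proj₂ (avoids u∈S) , proj₂ (avoids v∈S) ]′
                      (rim-geodesic-ends ij u≢v ¬Wuv ux xv) })
        (λ { refl → [ proj₁ (avoids u∈S) , proj₁ (avoids v∈S) ]′
                      (rim-geodesic-ends (CycAdj-sym ij) u≢v ¬Wuv ux xv) })

  no-free-edge⇒generating : ∀ {P} → (∀ e → ¬ FreeEdge P e) → Generating W P
  no-free-edge⇒generating {P} no-free S conv P⊆S = all-in-S
    where
    closed : MidpointClosed S
    closed = convex⇒midpointClosed conv
    selected-neighbour : ∀ {i j} → suc i ∉ P → CycAdj m j i → suc j ∈ P
    selected-neighbour {i} {j} i∉P ji with suc j ∈? P
    ... | yes j∈P = j∈P
    ... | no  j∉P = ⊥-elim (no-free (j , i) (ji , j∉P , i∉P))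
    rim-in-S : ∀ i → suc i ∈ S
    rim-in-S i with suc i ∈? P | CycAdj-neighbours 4≤m i
    ... | yes i∈P | _ = P⊆S i∈P
    ... | no  i∉P | p , s , pi , is , p≢s , ¬ps =
      closed (P⊆S (selected-neighbour i∉P pi)) (P⊆S (selected-neighbour i∉P (CycAdj-sym is)))
             (p≢s ∘ suc-injective) ¬ps pi is
    all-in-S : ∀ v → v ∈ S
    all-in-S (suc i) = rim-in-S i
    all-in-S zero with CycAdj-neighbours 4≤m (fromℕ< (≤-trans (s≤s z≤n) 4≤m))
    ... | p , s , _ , _ , p≢s , ¬ps =
      closed (rim-in-S p) (rim-in-S s) (p≢s ∘ suc-injective) ¬ps tt tt

  _∈ₑ_ : Fin (suc m) → Fin m × Fin m → Set
  v ∈ₑ (i , j) = v ≡ suc i ⊎ v ≡ suc j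

  _∈ₑ?_ : ∀ v e → Dec (v ∈ₑ e)
  v ∈ₑ? (i , j) = (v ≟ᶠ suc i) ⊎-dec (v ≟ᶠ suc j)

  CycAdj? : ∀ i j → Dec (CycAdj m i j)
  CycAdj? i j = (toℕ j ℕ.≟ suc (toℕ i)) ⊎-dec (toℕ i ℕ.≟ suc (toℕ j))
         ⊎-dec ((toℕ i ℕ.≟ 0) ×-dec (suc (toℕ j) ℕ.≟ m))
         ⊎-dec ((toℕ j ℕ.≟ 0) ×-dec (suc (toℕ i) ℕ.≟ m))

  FreeEdge? : ∀ P e → Dec (FreeEdge P e)
  FreeEdge? P (i , j) = CycAdj? i j ×-dec ¬? (suc i ∈? P) ×-dec ¬? (suc j ∈? P)

  free-edge? : ∀ P → Dec (∃ (FreeEdge P))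
  free-edge? P = map′ (λ (i , j , f) → (i , j) , f) (λ ((i , j) , f) → i , j , f)
                      (any? λ i → any? λ j → FreeEdge? P (i , j))

  FreeEdge-sym : ∀ {P i j} → FreeEdge P (i , j) → FreeEdge P (j , i)
  FreeEdge-sym (ij , i∉P , j∉P) = CycAdj-sym ij , j∉P , i∉P

  FreeEdge-unselect : ∀ {P v e} → FreeEdge (P ∪ ⁅ v ⁆) e → FreeEdge P e
  FreeEdge-unselect (ij , i∉ , j∉) = ij , proj₁ (x∉p∪⁅y⁆⁻ i∉) , proj₁ (x∉p∪⁅y⁆⁻ j∉)

  FreeEdge-select : ∀ {P} v {e} → FreeEdge P e → ¬ v ∈ₑ e → FreeEdge (P ∪ ⁅ v ⁆) e
  FreeEdge-select v (ij , i∉P , j∉P) v∉e =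
    ij , x∉p∪⁅y⁆⁺ i∉P (λ e → v∉e (inj₁ (sym e))) , x∉p∪⁅y⁆⁺ j∉P (λ e → v∉e (inj₂ (sym e)))

  -- Covers may use the centre, which covers nothing; this keeps padding and unselecting uniform.
  Cover : ∀ {k} → Subset (suc m) → Vec (Fin (suc m)) k → Set
  Cover P xs = ∀ e → FreeEdge P e → ∃ λ s → lookup xs s ∈ₑ e

  Cover≤ : ℕ → Subset (suc m) → Set
  Cover≤ k P = Σ (Vec (Fin (suc m)) k) (Cover P)

  Cover? : ∀ {k} P (xs : Vec (Fin (suc m)) k) → Dec (Cover P xs)
  Cover? P xs = map′ (λ c e → c (proj₁ e) (proj₂ e)) (λ c i j → c (i , j))
    (all? λ i → all? λ j → FreeEdge? P (i , j) →-dec any? λ s → lookup xs s ∈ₑ? (i , j))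

  Cover≤? : ∀ k P → Dec (Cover≤ k P)
  Cover≤? k P = ∃-Vec? any? (Cover? P)

  Cover≤0⇒no-free-edge : ∀ {P} → Cover≤ 0 P → ∀ e → ¬ FreeEdge P e
  Cover≤0⇒no-free-edge ([] , c) e f with () ← c e f

  no-free-edge⇒Cover≤0 : ∀ {P} → (∀ e → ¬ FreeEdge P e) → Cover≤ 0 P
  no-free-edge⇒Cover≤0 none = [] , λ e f → contradiction f (none e)

  generating⇔Cover≤0 : ∀ {P} → Generating W P ⇔ Cover≤ 0 P
  generating⇔Cover≤0 = mk⇔ (no-free-edge⇒Cover≤0 ∘ generating⇒no-free-edge)
                           (no-free-edge⇒generating ∘ Cover≤0⇒no-free-edge)

  ¬Cover≤0⇒free-edge : ∀ {P} → ¬ Cover≤ 0 P → ∃ (FreeEdge P)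
  ¬Cover≤0⇒free-edge {P} ¬cover =
    decidable-stable (free-edge? P) λ none → ¬cover (no-free-edge⇒Cover≤0 λ e f → none (e , f))

  Cover≤-suc : ∀ {k P} → Cover≤ k P → Cover≤ (suc k) P
  Cover≤-suc (xs , c) = zero ∷ xs , λ e f → let s , s∈e = c e f in suc s , s∈e

  Cover≤-weaken : ∀ {k l P} → k ≤ l → Cover≤ k P → Cover≤ l P
  Cover≤-weaken k≤l = go (≤⇒≤′ k≤l)
    where
    go : ∀ {k l P} → k ≤′ l → Cover≤ k P → Cover≤ l P
    go (≤′-reflexive refl) c = c
    go (≤′-step k≤′l)      c = Cover≤-suc (go k≤′l c)

  Cover≤-select : ∀ {k P} v → Cover≤ k P → Cover≤ k (P ∪ ⁅ v ⁆)
  Cover≤-select v (xs , c) = xs , λ e f → c e (FreeEdge-unselect f)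

  Cover≤-unselect : ∀ {k P} v → Cover≤ k (P ∪ ⁅ v ⁆) → Cover≤ (suc k) P
  Cover≤-unselect v (xs , c) = v ∷ xs , covers
    where
    covers : Cover _ (v ∷ xs)
    covers e f with v ∈ₑ? e
    ... | yes v∈e = zero , v∈e
    ... | no  v∉e = let s , s∈e = c e (FreeEdge-select v f v∉e) in suc s , s∈e

  select-cover-vertex : ∀ {k P} → Cover≤ (suc k) P → ¬ Cover≤ k P →
                        ∃ λ v → v ∉ P × Cover≤ k (P ∪ ⁅ v ⁆)
  select-cover-vertex {P = P} (x ∷ xs , c) ¬cover with x ∈? P
  ... | yes x∈P = contradiction (xs , covers) ¬cover
    where
    covers : Cover P xs
    covers e f@(_ , i∉P , j∉P) with c e f
    ... | zero  , inj₁ refl = contradiction x∈P i∉P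
    ... | zero  , inj₂ refl = contradiction x∈P j∉P
    ... | suc s , s∈e       = s , s∈e
  ... | no x∉P = x , x∉P , xs , covers
    where
    x∈P∪x : x ∈ P ∪ ⁅ x ⁆
    x∈P∪x = q⊆p∪q P ⁅ x ⁆ (x∈⁅x⁆ x)
    covers : Cover (P ∪ ⁅ x ⁆) xs
    covers e f@(_ , i∉ , j∉) with c e (FreeEdge-unselect f)
    ... | zero  , inj₁ refl = contradiction x∈P∪x i∉
    ... | zero  , inj₂ refl = contradiction x∈P∪x j∉
    ... | suc s , s∈e       = s , s∈e

  record Matching (P : Subset (suc m)) (l : ℕ) : Set where
    field
      edge     : Fin l → Fin m × Fin m
      free     : ∀ t → FreeEdge P (edge t)
      disjoint : ∀ {t u v} → v ∈ₑ edge t → v ∈ₑ edge u → t ≡ u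

  open Matching

  matching⇒¬Cover≤ : ∀ {P l k} → Matching P l → k < l → ¬ Cover≤ k P
  matching⇒¬Cover≤ M k<l (xs , c) with pigeonhole k<l (λ t → proj₁ (c _ (free M t)))
  ... | t , u , t<u , same = <-irrefl (cong toℕ t≡u) t<u
    where
    t≡u : t ≡ u
    t≡u = disjoint M (proj₂ (c _ (free M t)))
                     (subst (λ s → lookup xs s ∈ₑ edge M u) (sym same) (proj₂ (c _ (free M u))))

  matching-select : ∀ {P l} v (M : Matching P l) → (∀ t → ¬ v ∈ₑ edge M t) → Matching (P ∪ ⁅ v ⁆) l
  matching-select v M untouched = record
    { edge     = edge M
    ; free     = λ t → FreeEdge-select v (free M t) (untouched t)
    ; disjoint = disjoint M
    }

  matching-count : ∀ {l P} (M : Matching P l) → (∀ v → v ∉ P → ∃ λ t → v ∈ₑ edge M t) →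
                   ∣ ∁ P ∣ ≡ 2 * l
  matching-count {zero} {P} M touched = begin
    ∣ ∁ P ∣       ≡⟨ cong ∣_∣ (Empty-unique λ (v , v∈∁P) → ¬Fin0 (proj₁ (touched v (x∈∁p⇒x∉p v∈∁P)))) ⟩
    ∣ ⊥ {suc m} ∣ ≡⟨ ∣⊥∣≡0 (suc m) ⟩
    0             ∎
    where open ≡-Reasoning
  matching-count {suc l} {P} M touched = begin
    ∣ ∁ P ∣            ≡⟨ ∣∁p∣≡1+∣∁p∪⁅x⁆∣ P (suc i) (proj₁ (proj₂ (free M zero))) ⟩
    suc ∣ ∁ P₁ ∣       ≡⟨ cong suc (∣∁p∣≡1+∣∁p∪⁅x⁆∣ P₁ (suc j) j∉P₁) ⟩
    suc (suc ∣ ∁ P₂ ∣) ≡⟨ cong (λ c → suc (suc c)) (matching-count M₂ touched₂) ⟩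
    suc (suc (2 * l))  ≡⟨ sym (*-suc 2 l) ⟩
    2 * suc l          ∎
    where
    open ≡-Reasoning
    i j : Fin m
    i = proj₁ (edge M zero)
    j = proj₂ (edge M zero)
    P₁ P₂ : Subset (suc m)
    P₁ = P ∪ ⁅ suc i ⁆
    P₂ = P₁ ∪ ⁅ suc j ⁆
    j∉P₁ : suc j ∉ P₁
    j∉P₁ = x∉p∪⁅y⁆⁺ (proj₂ (proj₂ (free M zero))) λ j≡i →
      CycAdj-irrefl 2≤m (subst (CycAdj m i) (suc-injective j≡i) (proj₁ (free M zero)))
    untouched : ∀ t {v} → v ∈ₑ edge M zero → ¬ v ∈ₑ edge M (suc t)
    untouched t v∈e₀ v∈e with () ← disjoint M v∈e₀ v∈e
    M₂ : Matching P₂ l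
    M₂ = record
      { edge     = edge M ∘ suc
      ; free     = λ t → FreeEdge-select (suc j)
                           (FreeEdge-select (suc i) (free M (suc t)) (untouched t (inj₁ refl)))
                           (untouched t (inj₂ refl))
      ; disjoint = λ v∈t v∈u → suc-injective (disjoint M v∈t v∈u)
      }
    touched₂ : ∀ v → v ∉ P₂ → ∃ λ t → v ∈ₑ edge M₂ t
    touched₂ v v∉P₂ with x∉p∪⁅y⁆⁻ v∉P₂
    ... | v∉P₁ , v≢j with x∉p∪⁅y⁆⁻ v∉P₁
    ...   | v∉P , v≢i with touched v v∉P
    ...     | zero  , inj₁ v≡i = contradiction v≡i v≢i
    ...     | zero  , inj₂ v≡j = contradiction v≡j v≢j
    ...     | suc t , v∈e      = t , v∈e

  -- The matched vertices are an even number of unselected vertices, so an odd number of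
  -- unselected vertices leaves one off the matching.
  matching-extend : ∀ {l P} (M : Matching P l) → parity ∣ ∁ P ∣ ≡ 1ℙ →
                    ∃ λ v → v ∉ P × Matching (P ∪ ⁅ v ⁆) l
  matching-extend {l} {P} M odd
    with any? (λ v → ¬? (v ∈? P) ×-dec ¬? (any? λ t → v ∈ₑ? edge M t))
  ... | yes (v , v∉P , untouched) = v , v∉P , matching-select v M λ t v∈e → untouched (t , v∈e)
  ... | no  none = contradiction (trans (sym (*-homo-* 2 l)) (trans (sym (cong parity count)) odd))
                                 λ ()
    where
    count : ∣ ∁ P ∣ ≡ 2 * l
    count = matching-count M λ v v∉P →
      decidable-stable (any? λ t → v ∈ₑ? edge M t) λ untouched → none (v , v∉P , untouched)

  matching₁ : ∀ {P e} → FreeEdge P e → Matching P 1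
  matching₁ {e = e} f = record
    { edge = λ _ → e ; free = λ _ → f ; disjoint = λ { {zero} {zero} _ _ → refl } }

  matching₂ : ∀ {P e e′} → FreeEdge P e → FreeEdge P e′ → (∀ {v} → v ∈ₑ e → ¬ v ∈ₑ e′) →
              Matching P 2
  matching₂ {e = e} {e′} f f′ e∩e′=∅ = record
    { edge     = λ { zero → e ; (suc _) → e′ }
    ; free     = λ { zero → f ; (suc zero) → f′ }
    ; disjoint = λ { {zero}     {zero}     _    _    → refl
                   ; {zero}     {suc zero} v∈e  v∈e′ → contradiction v∈e′ (e∩e′=∅ v∈e)
                   ; {suc zero} {zero}     v∈e′ v∈e  → contradiction v∈e′ (e∩e′=∅ v∈e)
                   ; {suc zero} {suc zero} _    _    → refl }
    }

  uncovered-by : ∀ {P} x → ¬ Cover P (x ∷ []) → ∃ λ e → FreeEdge P e × ¬ x ∈ₑ e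
  uncovered-by {P} x ¬cover
    with any? (λ i → any? λ j → FreeEdge? P (i , j) ×-dec ¬? (x ∈ₑ? (i , j)))
  ... | yes (i , j , f , x∉e) = (i , j) , f , x∉e
  ... | no  none              = contradiction covers ¬cover
    where
    covers : Cover P (x ∷ [])
    covers (i , j) f with x ∈ₑ? (i , j)
    ... | yes x∈e = zero , x∈e
    ... | no  x∉e = contradiction (i , j , f , x∉e) none

  orient : ∀ {P b e} → suc b ∈ₑ e → FreeEdge P e →
           ∃ λ x → FreeEdge P (b , x) × (∀ {v} → v ∈ₑ (b , x) → v ∈ₑ e)
  orient {e = _ , d} (inj₁ refl) f = d , f , λ v∈ → v∈
  orient {e = c , _} (inj₂ refl) f = c , FreeEdge-sym f , Sum.swap

  -- A free edge ab, a free edge avoiding a and one avoiding b: either two of them are disjoint,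
  -- or they are bx and ay with x ≠ y (as there is no triangle abx), which are disjoint.
  ¬Cover≤1⇒matching : ∀ {P} → ¬ Cover≤ 1 P → Matching P 2
  ¬Cover≤1⇒matching {P} ¬cover with ¬Cover≤0⇒free-edge (¬cover ∘ Cover≤-suc)
  ... | (a , b) , fab
    with uncovered-by (suc a) (λ c → ¬cover (_ ∷ [] , c))
       | uncovered-by (suc b) (λ c → ¬cover (_ ∷ [] , c))
  ... | e₁ , f₁ , a∉e₁ | e₂ , f₂ , b∉e₂ with suc b ∈ₑ? e₁ | suc a ∈ₑ? e₂
  ... | no b∉e₁  | _        = matching₂ fab f₁ λ { (inj₁ refl) → a∉e₁ ; (inj₂ refl) → b∉e₁ }
  ... | yes _    | no a∉e₂  = matching₂ fab f₂ λ { (inj₁ refl) → a∉e₂ ; (inj₂ refl) → b∉e₂ }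
  ... | yes b∈e₁ | yes a∈e₂ with orient b∈e₁ f₁ | orient a∈e₂ f₂
  ... | x , fbx , bx⊆e₁ | y , fay , ay⊆e₂ with x ≟ᶠ y
  ...   | yes refl = contradiction (proj₁ fay) (CycAdj-triangle-free 4≤m (proj₁ fab) (proj₁ fbx))
  ...   | no  x≢y  = matching₂ fbx fay λ
          { (inj₁ refl) v∈ay       → b∉e₂ (ay⊆e₂ v∈ay)
          ; (inj₂ refl) (inj₁ x≡a) → a∉e₁ (bx⊆e₁ (inj₂ (sym x≡a)))
          ; (inj₂ refl) (inj₂ x≡y) → x≢y (suc-injective x≡y) }

  ¬Cover≤⇒matching : ∀ {P k} → k ≤ 1 → ¬ Cover≤ k P → Matching P (suc k)
  ¬Cover≤⇒matching z≤n       ¬cover = matching₁ (proj₂ (¬Cover≤0⇒free-edge ¬cover))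
  ¬Cover≤⇒matching (s≤s z≤n) ¬cover = ¬Cover≤1⇒matching ¬cover

  cycle-matching : ∀ {l} → 2 * l ≤ m → Matching ⊥ l
  cycle-matching {l} 2l≤m = record
    { edge     = λ t → fromℕ< (<⇒≤ (2t+2≤m t)) , fromℕ< (2t+2≤m t)
    ; free     = λ t → inj₁ (trans (toℕ-fromℕ< _) (cong suc (sym (toℕ-fromℕ< _)))) , ∉⊥ , ∉⊥
    ; disjoint = λ {t} {u} v∈t v∈u → toℕ-injective (pair-index (index {t} v∈t) (index {u} v∈u))
    }
    where
    2t+2≤m : ∀ (t : Fin l) → suc (suc (2 * toℕ t)) ≤ m
    2t+2≤m t = ≤-trans (≤-reflexive (sym (*-suc 2 (toℕ t)))) (≤-trans (*-monoʳ-≤ 2 (toℕ<n t)) 2l≤m)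
    index : ∀ {t v} → v ∈ₑ (fromℕ< (<⇒≤ (2t+2≤m t)) , fromℕ< (2t+2≤m t)) →
            pred (toℕ v) ≡ 2 * toℕ t ⊎ pred (toℕ v) ≡ suc (2 * toℕ t)
    index (inj₁ refl) = inj₁ (toℕ-fromℕ< _)
    index (inj₂ refl) = inj₂ (toℕ-fromℕ< _)

  -- Class P c says c = min (τ P) 3, where τ P is the least size of a cover of the free edges.
  data Class (P : Subset (suc m)) : ℕ → Set where
    class₀ : Cover≤ 0 P → Class P 0
    class₁ : ¬ Cover≤ 0 P → Cover≤ 1 P → Class P 1
    class₂ : ¬ Cover≤ 1 P → Cover≤ 2 P → Class P 2
    class₃ : ¬ Cover≤ 2 P → Class P 3

  classify : ∀ P → ∃ (Class P)
  classify P with Cover≤? 0 P | Cover≤? 1 P | Cover≤? 2 P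
  ... | yes c₀ | _      | _      = 0 , class₀ c₀
  ... | no ¬c₀ | yes c₁ | _      = 1 , class₁ ¬c₀ c₁
  ... | no _   | no ¬c₁ | yes c₂ = 2 , class₂ ¬c₁ c₂
  ... | no _   | no _   | no ¬c₂ = 3 , class₃ ¬c₂

  class≤3 : ∀ {P c} → Class P c → c ≤ 3
  class≤3 (class₀ _)   = z≤n
  class≤3 (class₁ _ _) = s≤s z≤n
  class≤3 (class₂ _ _) = s≤s (s≤s z≤n)
  class≤3 (class₃ _)   = ≤-refl

  class-cover : ∀ {P c} → Class P c → c ≤ 2 → Cover≤ c P
  class-cover (class₀ c₀)   _ = c₀
  class-cover (class₁ _ c₁) _ = c₁
  class-cover (class₂ _ c₂) _ = c₂
  class-cover (class₃ _)    (s≤s (s≤s ()))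

  class-¬cover : ∀ {P c} → Class P (suc c) → ¬ Cover≤ c P
  class-¬cover (class₁ ¬c₀ _) = ¬c₀
  class-¬cover (class₂ ¬c₁ _) = ¬c₁
  class-¬cover (class₃ ¬c₂)   = ¬c₂

  class-upper : ∀ {P c k} → Cover≤ k P → Class P c → c ≤ k
  class-upper {c = zero}      _     _  = z≤n
  class-upper {c = suc c} {k} cover cl = decidable-stable (suc c ≤? k) λ c≰k →
    class-¬cover cl (Cover≤-weaken (≤-pred (≰⇒> c≰k)) cover)

  class-lower : ∀ {P c k} → k ≤ 2 → ¬ Cover≤ k P → Class P c → k < c
  class-lower {c = c} {k} k≤2 ¬cover cl = decidable-stable (suc k ≤? c) λ k≮c →
    ¬cover (Cover≤-weaken (≮⇒≥ k≮c) (class-cover cl (≤-trans (≮⇒≥ k≮c) k≤2)))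

  option-class : ∀ {P c c′} v → Class P c → Class (P ∪ ⁅ v ⁆) c′ → pred c ≤ c′ × c′ ≤ c
  option-class v (class₀ c₀)     cl′ = z≤n , class-upper (Cover≤-select v c₀) cl′
  option-class v (class₁ _ c₁)   cl′ = z≤n , class-upper (Cover≤-select v c₁) cl′
  option-class v (class₂ ¬c₁ c₂) cl′ =
    class-lower z≤n (¬c₁ ∘ Cover≤-unselect v) cl′ , class-upper (Cover≤-select v c₂) cl′
  option-class v (class₃ ¬c₂)    cl′ =
    class-lower (s≤s z≤n) (¬c₂ ∘ Cover≤-unselect v) cl′ , class≤3 cl′

  option-down : ∀ {P k} → Class P (suc k) → suc k ≤ 2 →
                ∃ λ v → v ∉ P × ∀ {c′} → Class (P ∪ ⁅ v ⁆) c′ → c′ ≡ k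
  option-down cl k<2 with select-cover-vertex (class-cover cl k<2) (class-¬cover cl)
  ... | v , v∉P , cover =
    v , v∉P , λ cl′ → ≤-antisym (class-upper cover cl′) (proj₁ (option-class v cl cl′))

  option-same : ∀ {P k} → Class P (suc k) → suc k ≤ 2 → parity ∣ ∁ P ∣ ≡ 1ℙ →
                ∃ λ v → v ∉ P × ∀ {c′} → Class (P ∪ ⁅ v ⁆) c′ → c′ ≡ suc k
  option-same cl (s≤s k≤1) odd with matching-extend (¬Cover≤⇒matching k≤1 (class-¬cover cl)) odd
  ... | v , v∉P , M = v , v∉P , λ cl′ →
    ≤-antisym (proj₂ (option-class v cl cl′))
              (class-lower (≤-trans k≤1 (s≤s z≤n)) (matching⇒¬Cover≤ M ≤-refl) cl′)

module Nim (m : ℕ) (4≤m : 4 ≤ m)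
           (gen? : (P : Subset (suc m)) → Dec (Generating (Wheel (suc m)) P)) where

  open WheelPositions m 4≤m

  options : ℕ → Subset (suc m) → List ℕ
  options f P = map (λ v → nimPos W gen? f (P ∪ ⁅ v ⁆)) (unselected W gen? P)

  ∈-options : ∀ {f P v} → v ∉ P → nimPos W gen? f (P ∪ ⁅ v ⁆) ∈ˡ options f P
  ∈-options {f} {P} {v} v∉P = ∈-map⁺ _ (∈-filter⁺ (λ w → ¬? (w ∈? P)) (∈-allFin v) v∉P)

  All-options : ∀ {f P} {Q : ℕ → Set} → (∀ {v} → v ∉ P → Q (nimPos W gen? f (P ∪ ⁅ v ⁆))) →
                All Q (options f P)
  All-options {P = P} q =
    All.map⁺ (All.tabulate λ v∈ → q (proj₂ (∈-filter⁻ (λ w → ¬? (w ∈? P)) {xs = allFin _} v∈)))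

  nimPos≡nimValue : ∀ f P {c} → Class P c → ∣ ∁ P ∣ ≤ f →
                    nimPos W gen? f P ≡ nimValue c (parity ∣ ∁ P ∣)
  nimPos≡nimValue zero P cl u≤0 with class-upper (no-free-edge⇒Cover≤0 none-free) cl
    where
    none-free : ∀ e → ¬ FreeEdge P e
    none-free (i , _) (_ , i∉P , _) with () ← subst (_≤ 0) (∣∁p∣≡1+∣∁p∪⁅x⁆∣ P (suc i) i∉P) u≤0
  ... | z≤n = refl
  nimPos≡nimValue (suc f) P cl u≤ with gen? P
  ... | yes gen with class-upper (Equivalence.to generating⇔Cover≤0 gen) cl
  ...   | z≤n = refl
  nimPos≡nimValue (suc f) P {zero}  (class₀ c₀) _ | no ¬gen =
    contradiction (Equivalence.from generating⇔Cover≤0 c₀) ¬gen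
  nimPos≡nimValue (suc f) P {suc k} cl u≤ | no ¬gen =
    mex-options k p (options f P) (≤-pred (class≤3 cl)) values nonempty down same
    where
    p : Parity
    p = parity ∣ ∁ P ∣
    option-value : ∀ {v c′} → v ∉ P → Class (P ∪ ⁅ v ⁆) c′ →
                   nimPos W gen? f (P ∪ ⁅ v ⁆) ≡ nimValue c′ (p ⁻¹)
    option-value {v} v∉P cl′ =
      trans (nimPos≡nimValue f (P ∪ ⁅ v ⁆) cl′ fuel) (cong (nimValue _) parity-flips)
      where
      count : ∣ ∁ P ∣ ≡ suc ∣ ∁ (P ∪ ⁅ v ⁆) ∣
      count = ∣∁p∣≡1+∣∁p∪⁅x⁆∣ P v v∉P
      fuel : ∣ ∁ (P ∪ ⁅ v ⁆) ∣ ≤ f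
      fuel = ≤-pred (subst (_≤ suc f) count u≤)
      parity-flips : parity ∣ ∁ (P ∪ ⁅ v ⁆) ∣ ≡ p ⁻¹
      parity-flips = trans (sym (suc-homo-⁻¹ ∣ ∁ (P ∪ ⁅ v ⁆) ∣)) (cong (λ n → parity n ⁻¹) (sym count))
    option-of-class : ∀ {v c} → v ∉ P → (∀ {c′} → Class (P ∪ ⁅ v ⁆) c′ → c′ ≡ c) →
                      nimValue c (p ⁻¹) ∈ˡ options f P
    option-of-class {v} v∉P class≡ with c′ , cl′ ← classify (P ∪ ⁅ v ⁆) with refl ← class≡ cl′ =
      subst (_∈ˡ options f P) (option-value v∉P cl′) (∈-options {f} v∉P)
    values : All (λ x → x ≡ nimValue k (p ⁻¹) ⊎ x ≡ nimValue (suc k) (p ⁻¹)) (options f P)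
    values = All-options {f} λ {v} v∉P →
      let c′ , cl′ = classify (P ∪ ⁅ v ⁆) ; k≤c′ , c′≤k+1 = option-class v cl cl′ in
      Sum.map (λ c′≡k → trans (option-value v∉P cl′) (cong (λ c → nimValue c (p ⁻¹)) c′≡k))
              (λ c′≡k+1 → trans (option-value v∉P cl′) (cong (λ c → nimValue c (p ⁻¹)) c′≡k+1))
              (between-suc k≤c′ c′≤k+1)
    nonempty : options f P ≢ []
    nonempty none
      with (i , _) , (_ , i∉P , _) ← ¬Cover≤0⇒free-edge (¬gen ∘ Equivalence.from generating⇔Cover≤0)
      with () ← subst (nimPos W gen? f (P ∪ ⁅ suc i ⁆) ∈ˡ_) none (∈-options {f} i∉P)
    down : k ≤ 1 → nimValue k (p ⁻¹) ∈ˡ options f P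
    down k≤1 with v , v∉P , class≡k ← option-down cl (s≤s k≤1) = option-of-class v∉P class≡k
    same : k ≤ 1 → p ≡ 1ℙ → nimValue (suc k) (p ⁻¹) ∈ˡ options f P
    same k≤1 odd with v , v∉P , class≡k+1 ← option-same cl (s≤s k≤1) odd =
      option-of-class v∉P class≡k+1

nimGEN-Wheel≡nimValue : ∀ m (4≤m : 4 ≤ m) gen? {c} → WheelPositions.Class m 4≤m ⊥ c →
                        nimGEN (Wheel (suc m)) gen? ≡ nimValue c (parity (suc m))
nimGEN-Wheel≡nimValue m 4≤m gen? {c} cl =
  trans (Nim.nimPos≡nimValue m 4≤m gen? (suc m) ⊥ cl (≤-reflexive count))
        (cong (nimValue c ∘ parity) count)
  where
  count : ∣ ∁ (⊥ {suc m}) ∣ ≡ suc m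
  count = trans (∣∁p∣≡n∸∣p∣ (⊥ {suc m})) (cong (suc m ∸_) (∣⊥∣≡0 (suc m)))

nimGEN-W₅ : ∀ {n} → n ≡ 5 → (gen? : (P : Subset n) → Dec (Generating (Wheel n) P)) →
            nimGEN (Wheel n) gen? ≡ 2
nimGEN-W₅ refl gen? =
  nimGEN-Wheel≡nimValue 4 ≤-refl gen? (class₂ (matching⇒¬Cover≤ (cycle-matching ≤-refl) ≤-refl)
                                              (from-yes (Cover≤? 2 ⊥)))
  where open WheelPositions 4 ≤-refl

nimGEN-W≥6 : ∀ {n} → 6 ≤ n → (gen? : (P : Subset n) → Dec (Generating (Wheel n) P)) →
             nimGEN (Wheel n) gen? ≡ n % 2
nimGEN-W≥6 {suc m} (s≤s 5≤m) gen? =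
  trans (nimGEN-Wheel≡nimValue m 4≤m gen? (class₃ ¬cover)) (nimValue-3-parity (suc m))
  where
  4≤m : 4 ≤ m
  4≤m = ≤-trans (n≤1+n 4) 5≤m
  open WheelPositions m 4≤m
  -- C₅ has no three disjoint edges; there τ = 3 is checked by evaluation.
  ¬cover : ¬ Cover≤ 2 ⊥
  ¬cover with m ℕ.≟ 5
  ... | yes refl = from-no (Cover≤? 2 ⊥)
  ... | no  m≢5  = matching⇒¬Cover≤ (cycle-matching (≤∧≢⇒< 5≤m (m≢5 ∘ sym))) ≤-refl

proposition7p25 : (n : ℕ) → 5 ≤ n →
    (gen? : (P : Subset n) → Dec (Generating (Wheel n) P)) →
    (n ≡ 5 → nimGEN (Wheel n) gen? ≡ 2) × (6 ≤ n → nimGEN (Wheel n) gen? ≡ n % 2)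
proposition7p25 n _ gen? = (λ n≡5 → nimGEN-W₅ n≡5 gen?) , (λ 6≤n → nimGEN-W≥6 6≤n gen?)
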